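{- Let $a,b$ be nonnegative integers with $a+b=m$, let $K_{a,b}$ be the complete bipartite graph with sides $A$ of size $a$ and $B$ of size $b$, and let $x>2$. Then $$\widetilde{T}_{K_{a,b}}(x,1) \widetilde{T}_{K_{a,b}}(1,x)\geq \left(\frac{x^2}{4(x-1)}\right)^m.$$
   Context: A bipartite graph $H=(A,B,E)$ comes with designated sides $A,B$ (isolated vertices allowed). For $m=|V(H)|$ and a permutation $\pi$ of $V(H)$ (a bijection to $[m]$), a vertex $i\in A$ is internally active if $\pi(i)>\pi(j)$ for all neighbours $j$ of $i$, and $j\in B$ is externally active if $\pi(j)>\pi(i)$ for all neighbours $i$ of $j$ (vacuous for isolated vertices); $\mathrm{ia}(\pi),\mathrm{ea}(\pi)$ are their numbers, and $\widetilde{T}_H(x,y)=\frac{1}{m!}\sum_{\pi}x^{\mathrm{ia}(\pi)}y^{\mathrm{ea}(\pi)}$.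
   Formalization: The parameter x ranges over the rationals greater than 2. -}

module Defs where

open import Data.Bool using (Bool; true; false; if_then_else_)
open import Data.Nat as ℕ using (ℕ; zero; suc; _!)
open import Data.Nat.Properties using (_!≢0)
open import Data.Integer using (+_)
open import Data.Fin using (Fin)
open import Data.Sum using (_⊎_; inj₁; inj₂)
open import Data.List using (List; []; _∷_; map; concatMap; _++_; length)
open import Data.Bool.ListAction using (any)
open import Data.List using (allFin)
open import Data.Rational using (ℚ; 0ℚ; 1ℚ; _+_; _*_; _-_; _<_; _÷_; _/_; NonZero; Positive)
import Data.Rational as Q
open import Data.Rational.Properties using (+-monoˡ-<; pos*pos⇒pos; pos⇒nonZero; <-trans; _<?_)

2ℚ 4ℚ : ℚ
2ℚ = + 2 / 1
4ℚ = + 4 / 1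
open import Relation.Nullary.Decidable using (toWitness)

record BipGraph : Set where
  field
    a : ℕ
    b : ℕ
    E : Fin a → Fin b → Bool

open BipGraph public

Vertex : BipGraph → Set
Vertex H = Fin (a H) ⊎ Fin (b H)

vertices : (H : BipGraph) → List (Vertex H)
vertices H = map inj₁ (allFin (a H)) ++ map inj₂ (allFin (b H))

adj : (H : BipGraph) → Vertex H → Vertex H → Bool
adj H (inj₁ i) (inj₂ j) = E H i j
adj H (inj₂ j) (inj₁ i) = E H i j
adj H (inj₁ _) (inj₁ _) = false
adj H (inj₂ _) (inj₂ _) = false

K : ℕ → ℕ → BipGraph
K a b = record { a = a ; b = b ; E = λ _ _ → true }

-- Permutations of a list (all orderings), by insertion.
-- A permutation π of V(H) is represented by the list of vertices
-- ordered by π-value: the vertex at position k (0-based) has π = k+1.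

insertAll : {X : Set} → X → List X → List (List X)
insertAll x [] = (x ∷ []) ∷ []
insertAll x (y ∷ ys) = (x ∷ y ∷ ys) ∷ map (y ∷_) (insertAll x ys)

perms : {X : Set} → List X → List (List X)
perms [] = [] ∷ []
perms (x ∷ xs) = concatMap (insertAll x) (perms xs)

-- A vertex v at some position is active iff no neighbour of v occurs
-- later (i.e. π(v) > π(w) for all neighbours w).
-- ia counts active A-vertices (internally active),
-- ea counts active B-vertices (externally active).
ia : (H : BipGraph) → List (Vertex H) → ℕ
ia H [] = 0
ia H (inj₁ i ∷ rest) = (if any (adj H (inj₁ i)) rest then 0 else 1) ℕ.+ ia H rest
ia H (inj₂ j ∷ rest) = ia H rest

ea : (H : BipGraph) → List (Vertex H) → ℕ
ea H [] = 0
ea H (inj₁ i ∷ rest) = ea H rest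
ea H (inj₂ j ∷ rest) = (if any (adj H (inj₂ j)) rest then 0 else 1) ℕ.+ ea H rest

infixr 8 _^_
_^_ : ℚ → ℕ → ℚ
p ^ zero = 1ℚ
p ^ suc n = p * (p ^ n)

sumℚ : List ℚ → ℚ
sumℚ [] = 0ℚ
sumℚ (p ∷ ps) = p + sumℚ ps

m : BipGraph → ℕ
m H = a H ℕ.+ b H

T̃ : BipGraph → ℚ → ℚ → ℚ
T̃ H x y =
  sumℚ (map (λ σ → (x ^ ia H σ) * (y ^ ea H σ)) (perms (vertices H)))
    * ((+ 1 / (m H !)) {{m H !≢0}})

4[x-1]≢0 : (x : ℚ) → 2ℚ < x → NonZero (4ℚ * (x - 1ℚ))
4[x-1]≢0 x h = pos⇒nonZero (4ℚ * (x - 1ℚ)) {{pos*pos⇒pos 4ℚ (x - 1ℚ) {{pos}}}}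
  where
  2ℚ-1 : 1ℚ < x - 1ℚ
  2ℚ-1 = +-monoˡ-< (Q.- 1ℚ) h
  pos : Positive (x - 1ℚ)
  pos = Q.positive (<-trans (toWitness {a? = 0ℚ <? 1ℚ} _) 2ℚ-1)

base : (x : ℚ) → 2ℚ < x → ℚ
base x h = ((x * x) ÷ (4ℚ * (x - 1ℚ))) {{4[x-1]≢0 x h}}

-- For K_{a,b} an A-vertex is internally active iff no B-vertex comes after it, so ia(π) is the
-- length of the final run of A-vertices of the ordering π (`trailing`), and ea(π) that of
-- B-vertices. Inserting one more vertex in all positions shows that exactly
-- (a)_K (m-K)! = `arrangements a m K` orderings have their last K vertices in A, so by Abel
-- summation m! T̃(x,1) = W(a,b) := `activitySum x a b` = Σ_K Δ_K (a)_K (m-K)!, where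
-- Δ_K = x^K - x^(K-1) and Δ_0 = 1. W satisfies the first-vertex recursion
-- W(a+1,b+1) = (a+1) W(a,b+1) + (b+1) W(a+1,b) with W(a,0) = a! x^a and W(0,b) = b!, and along
-- this recursion a! b! τ(a,b) x^(a+b) ≤ 2^(a+b) (x-1)^b W(a,b), where
-- τ(a,b) = `binomialTail a b` = Σ_{j≥b} C(a+b,j) ≥ C(a+b,b). The inductive step is
-- x(A+B) ≤ 2A + 2(x-1)B for A ≤ B, i.e. (x-2)(B-A) ≥ 0, and A ≤ B is the monotonicity of
-- binomial tails. Hence T̃(x,1) ≥ (x/2)^m / (x-1)^b and T̃(1,x) ≥ (x/2)^m / (x-1)^a, and the
-- product of these bounds is (x²/(4(x-1)))^m.

module Submission where

open import Defs
open import Data.Nat using (ℕ; _+_)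
open import Data.Rational using (ℚ; 1ℚ; _*_; _<_; _≤_)

open import Algebra.Bundles using (CommutativeMonoid; CommutativeRing)
import Algebra.Properties.CommutativeSemigroup as CommSemigroupProperties
open import Data.Bool using (Bool; true; false; if_then_else_; _∧_; not)
open import Data.Bool.ListAction using (all; any)
open import Data.Bool.Properties using (∧-commutativeMonoid)
import Data.Integer as ℤ
open import Data.Integer.Tactic.RingSolver using () renaming (solve-∀ to ℤ-solve-∀)
open import Data.List using (List; []; _∷_; _++_; map; concatMap; length; allFin)
open import Data.List.Properties
  using (map-∘; map-++; map-cong; map-cong-local; length-map; length-++; length-tabulate)
open import Data.List.Relation.Unary.All as All using (All; []; _∷_)
open import Data.List.Relation.Unary.All.Properties using (map⁺; concat⁺)
open import Data.Nat as ℕ using (zero; suc; _∸_; _!)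
open import Data.Nat.ListAction using (sum)
open import Data.Nat.ListAction.Properties using (sum-++)
import Data.Nat.Properties as ℕ
open import Data.Nat.Properties using (_!≢0)
open import Data.Nat.Tactic.RingSolver using (solve-∀)
open import Data.Rational using (0ℚ; _/_)
import Data.Rational as ℚ
import Data.Rational.Properties as ℚ
open import Data.Rational.Solver using (module +-*-Solver)
import Data.Rational.Unnormalised as ℚᵘ
import Data.Rational.Unnormalised.Properties as ℚᵘ
open import Data.Sum using (_⊎_; inj₁; inj₂)
open import Function using (_∘_)
open import Relation.Binary.PropositionalEquality
  using (_≡_; refl; sym; trans; cong; cong₂; subst; subst₂; module ≡-Reasoning)
open import Relation.Nullary using (yes; no)

open import Algebra.Properties.Semiring.Mult (CommutativeRing.semiring ℚ.+-*-commutativeRing)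
  using (_×_; ×-homo-+; ×1-homo-*)
module ℕ+ = CommSemigroupProperties ℕ.+-commutativeSemigroup
module ℕ* = CommSemigroupProperties ℕ.*-commutativeSemigroup
module ℚ+ = CommSemigroupProperties (CommutativeMonoid.commutativeSemigroup ℚ.+-0-commutativeMonoid)
module ℚ* = CommSemigroupProperties (CommutativeMonoid.commutativeSemigroup ℚ.*-1-commutativeMonoid)
module ∧ = CommSemigroupProperties (CommutativeMonoid.commutativeSemigroup ∧-commutativeMonoid)

-- Indicators and falling factorials

𝟙[_≤_] : ℕ → ℕ → ℕ
𝟙[ zero  ≤ _     ] = 1
𝟙[ suc K ≤ zero  ] = 0
𝟙[ suc K ≤ suc k ] = 𝟙[ K ≤ k ]

𝟙-≤ : ∀ {K k} → K ℕ.≤ k → 𝟙[ K ≤ k ] ≡ 1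
𝟙-≤ ℕ.z≤n       = refl
𝟙-≤ (ℕ.s≤s K≤k) = 𝟙-≤ K≤k

𝟙-> : ∀ {K k} → k ℕ.< K → 𝟙[ K ≤ k ] ≡ 0
𝟙-> {suc K} {zero}  _           = refl
𝟙-> {suc K} {suc k} (ℕ.s≤s k<K) = 𝟙-> k<K

𝟙-suc : ∀ K k → 𝟙[ K ≤ suc k ] ≡ 𝟙[ K ∸ 1 ≤ k ]
𝟙-suc zero    k = refl
𝟙-suc (suc K) k = refl

𝟙-absorb : ∀ K {k n} → k ℕ.≤ n →
  𝟙[ K ≤ k ] + (n ∸ K) ℕ.* 𝟙[ K ≤ k ] ≡ (suc n ∸ K) ℕ.* 𝟙[ K ≤ k ]
𝟙-absorb zero    _                 = refl
𝟙-absorb (suc K) {zero}  {n} _     = trans (ℕ.*-zeroʳ (n ∸ suc K)) (sym (ℕ.*-zeroʳ (n ∸ K)))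
𝟙-absorb (suc K) {suc k} (ℕ.s≤s k≤n) = 𝟙-absorb K k≤n

𝟙-widen : ∀ K n → (suc n ∸ K) ℕ.* 𝟙[ K ≤ n ] ≡ (suc n ∸ K) ℕ.* 𝟙[ K ≤ suc n ]
𝟙-widen zero          n       = refl
𝟙-widen (suc zero)    zero    = refl
𝟙-widen (suc (suc K)) zero    = refl
𝟙-widen (suc K)       (suc n) = 𝟙-widen K n

falling : ℕ → ℕ → ℕ
falling c       zero    = 1
falling zero    (suc K) = 0
falling (suc c) (suc K) = suc c ℕ.* falling c K

falling-vanish : ∀ {c K} → c ℕ.< K → falling c K ≡ 0
falling-vanish {zero}  {suc K} _           = refl
falling-vanish {suc c} {suc K} (ℕ.s≤s c<K) = trans (cong (suc c ℕ.*_) (falling-vanish c<K)) (ℕ.*-zeroʳ (suc c))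

falling-step : ∀ c K → falling c (suc K) ≡ (c ∸ K) ℕ.* falling c K
falling-step zero    zero    = refl
falling-step zero    (suc K) = refl
falling-step (suc c) zero    = refl
falling-step (suc c) (suc K) =
  trans (cong (suc c ℕ.*_) (falling-step c K)) (ℕ*.x∙yz≈y∙xz (suc c) (c ∸ K) (falling c K))

falling-pascal : ∀ c K → falling (suc c) (suc K) ≡ falling c (suc K) + suc K ℕ.* falling c K
falling-pascal zero    zero    = refl
falling-pascal zero    (suc K) = sym (ℕ.*-zeroʳ (suc (suc K)))
falling-pascal (suc c) zero    = ℕ.+-comm 1 (suc c ℕ.* 1)
falling-pascal (suc c) (suc K) = begin
  suc c ℕ.* F + suc c ℕ.* (suc c ℕ.* F)      ≡⟨ cong (λ t → suc c ℕ.* F + suc c ℕ.* t) (falling-pascal c K) ⟩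
  suc c ℕ.* F + suc c ℕ.* (G + suc K ℕ.* F)  ≡⟨ regroup c K F G ⟩
  suc c ℕ.* G + suc (suc K) ℕ.* (suc c ℕ.* F) ∎
  where
  open ≡-Reasoning
  F G : ℕ
  F = falling c K
  G = falling c (suc K)
  regroup : ∀ c K F G →
    suc c ℕ.* F + suc c ℕ.* (G + suc K ℕ.* F) ≡ suc c ℕ.* G + suc (suc K) ℕ.* (suc c ℕ.* F)
  regroup = solve-∀

[1+n∸K]! : ∀ {K n} → K ℕ.≤ n → (suc n ∸ K) ! ≡ (suc n ∸ K) ℕ.* (n ∸ K) !
[1+n∸K]! K≤n rewrite ℕ.+-∸-assoc 1 K≤n = refl

arrangements : ℕ → ℕ → ℕ → ℕ
arrangements c n K = falling c K ℕ.* (n ∸ K) !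

arrangements-suc : ∀ {c n} K → c ℕ.≤ n → (suc n ∸ K) ℕ.* arrangements c n K ≡ arrangements c (suc n) K
arrangements-suc {c} {n} K c≤n with K ℕ.≤? n
... | yes K≤n rewrite [1+n∸K]! K≤n = ℕ*.x∙yz≈y∙xz (suc n ∸ K) (falling c K) ((n ∸ K) !)
... | no  K≰n rewrite falling-vanish (ℕ.<-≤-trans {c} (ℕ.s≤s c≤n) (ℕ.≰⇒> K≰n)) = ℕ.*-zeroʳ (suc n ∸ K)

arrangements-suc-suc : ∀ {c n} K → c ℕ.≤ n →
  (suc n ∸ K) ℕ.* arrangements c n K + K ℕ.* arrangements c n (K ∸ 1) ≡ arrangements (suc c) (suc n) K
arrangements-suc-suc zero    c≤n = trans (ℕ.+-identityʳ _) (arrangements-suc zero c≤n)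
arrangements-suc-suc {c} {n} (suc K) c≤n = begin
  (n ∸ K) ℕ.* arrangements c n (suc K) + suc K ℕ.* (falling c K ℕ.* D)
    ≡⟨ cong₂ _+_ (arrangements-suc (suc K) c≤n) (sym (ℕ.*-assoc (suc K) (falling c K) D)) ⟩
  falling c (suc K) ℕ.* D + suc K ℕ.* falling c K ℕ.* D
    ≡⟨ sym (ℕ.*-distribʳ-+ D (falling c (suc K)) _) ⟩
  (falling c (suc K) + suc K ℕ.* falling c K) ℕ.* D
    ≡⟨ cong (ℕ._* D) (sym (falling-pascal c K)) ⟩
  falling (suc c) (suc K) ℕ.* D ∎
  where
  open ≡-Reasoning
  D : ℕ
  D = (n ∸ K) !

arrangements-lattice : ∀ a b K →
  arrangements (suc a) (suc a + suc b) K
    ≡ suc a ℕ.* arrangements a (a + suc b) K + suc b ℕ.* arrangements (suc a) (suc a + b) K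
arrangements-lattice a b K with K ℕ.≤? suc a
... | yes K≤1+a = begin
  F ℕ.* (suc a + suc b ∸ K) !                        ≡⟨ cong (λ t → F ℕ.* t !) e₁ ⟩
  F ℕ.* (suc (u + b) ℕ.* M)                          ≡⟨ split F u b M ⟩
  u ℕ.* F ℕ.* M + suc b ℕ.* (F ℕ.* M)
    ≡⟨ cong (λ t → t ℕ.* M + suc b ℕ.* (F ℕ.* M)) (sym (falling-step (suc a) K)) ⟩
  suc a ℕ.* falling a K ℕ.* M + suc b ℕ.* (F ℕ.* M)
    ≡⟨ cong (_+ suc b ℕ.* (F ℕ.* M)) (ℕ.*-assoc (suc a) (falling a K) M) ⟩
  suc a ℕ.* (falling a K ℕ.* M) + suc b ℕ.* (F ℕ.* M)
    ≡⟨ cong₂ (λ s t → suc a ℕ.* (falling a K ℕ.* s !) + suc b ℕ.* (F ℕ.* t !)) (sym e₂) (sym e₃) ⟩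
  suc a ℕ.* arrangements a (a + suc b) K + suc b ℕ.* arrangements (suc a) (suc a + b) K ∎
  where
  open ≡-Reasoning
  F u M : ℕ
  F = falling (suc a) K
  u = suc a ∸ K
  M = (u + b) !
  e₃ : suc a + b ∸ K ≡ u + b
  e₃ = ℕ.+-∸-comm b K≤1+a
  e₂ : a + suc b ∸ K ≡ u + b
  e₂ = trans (cong (_∸ K) (ℕ.+-suc a b)) e₃
  e₁ : suc a + suc b ∸ K ≡ suc (u + b)
  e₁ = trans (ℕ.+-∸-comm (suc b) K≤1+a) (ℕ.+-suc u b)
  split : ∀ F u b M → F ℕ.* (suc (u + b) ℕ.* M) ≡ u ℕ.* F ℕ.* M + suc b ℕ.* (F ℕ.* M)
  split = solve-∀
... | no K≰1+a
  rewrite falling-vanish (ℕ.≰⇒> K≰1+a) | falling-vanish (ℕ.<⇒≤ (ℕ.≰⇒> K≰1+a)) =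
  sym (cong₂ _+_ (ℕ.*-zeroʳ (suc a)) (ℕ.*-zeroʳ (suc b)))

arrangements-all : ∀ a K → arrangements a a K ≡ a ! ℕ.* 𝟙[ K ≤ a ]
arrangements-all a       zero    = trans (ℕ.*-identityˡ (a !)) (sym (ℕ.*-identityʳ (a !)))
arrangements-all zero    (suc K) = refl
arrangements-all (suc a) (suc K) = begin
  suc a ℕ.* falling a K ℕ.* (a ∸ K) !    ≡⟨ ℕ.*-assoc (suc a) (falling a K) _ ⟩
  suc a ℕ.* (falling a K ℕ.* (a ∸ K) !)  ≡⟨ cong (suc a ℕ.*_) (arrangements-all a K) ⟩
  suc a ℕ.* (a ! ℕ.* 𝟙[ K ≤ a ])         ≡⟨ sym (ℕ.*-assoc (suc a) (a !) _) ⟩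
  suc a ℕ.* a ! ℕ.* 𝟙[ K ≤ a ]           ∎
  where open ≡-Reasoning

arrangements-none : ∀ n K → arrangements 0 n K ≡ n ! ℕ.* 𝟙[ K ≤ 0 ]
arrangements-none n zero    = trans (ℕ.*-identityˡ (n !)) (sym (ℕ.*-identityʳ (n !)))
arrangements-none n (suc K) = sym (ℕ.*-zeroʳ (n !))

-- Trailing runs in the orderings of a list

sum-map-+ : ∀ {X : Set} (f g : X → ℕ) xs → sum (map (λ x → f x + g x) xs) ≡ sum (map f xs) + sum (map g xs)
sum-map-+ f g []       = refl
sum-map-+ f g (x ∷ xs) = trans (cong (f x + g x +_) (sum-map-+ f g xs)) (ℕ+.interchange (f x) (g x) _ _)

sum-map-*ˡ : ∀ {X : Set} c (f : X → ℕ) xs → sum (map (λ x → c ℕ.* f x) xs) ≡ c ℕ.* sum (map f xs)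
sum-map-*ˡ c f []       = sym (ℕ.*-zeroʳ c)
sum-map-*ˡ c f (x ∷ xs) = trans (cong (c ℕ.* f x +_) (sum-map-*ˡ c f xs)) (sym (ℕ.*-distribˡ-+ c (f x) _))

sum-map-concatMap : ∀ {X Y : Set} (f : Y → ℕ) (g : X → List Y) xs →
  sum (map f (concatMap g xs)) ≡ sum (map (λ x → sum (map f (g x))) xs)
sum-map-concatMap f g []       = refl
sum-map-concatMap f g (x ∷ xs) = begin
  sum (map f (g x ++ concatMap g xs))              ≡⟨ cong sum (map-++ f (g x) _) ⟩
  sum (map f (g x) ++ map f (concatMap g xs))      ≡⟨ sum-++ (map f (g x)) _ ⟩
  sum (map f (g x)) + sum (map f (concatMap g xs)) ≡⟨ cong (sum (map f (g x)) +_) (sum-map-concatMap f g xs) ⟩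
  sum (map f (g x)) + sum (map (λ x → sum (map f (g x))) xs) ∎
  where open ≡-Reasoning

length-insertAll : ∀ {X : Set} (v : X) τ → All (λ w → length w ≡ suc (length τ)) (insertAll v τ)
length-insertAll v []      = refl ∷ []
length-insertAll v (u ∷ τ) = refl ∷ map⁺ (All.map (cong suc) (length-insertAll v τ))

length-perms : ∀ {X : Set} (L : List X) → All (λ σ → length σ ≡ length L) (perms L)
length-perms []      = refl ∷ []
length-perms (v ∷ L) =
  concat⁺ (map⁺ (All.map (λ {τ} eq → All.map (λ eq′ → trans eq′ (cong suc eq)) (length-insertAll v τ))
                          (length-perms L)))

positions-extending : ∀ β {k n} (G : ℕ → ℕ) → k ℕ.≤ n → let bump t = if β then suc t else t in
  G (bump (bump k)) + (suc k ℕ.* G (bump (suc k)) + (n ∸ k) ℕ.* G (bump k))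
    ≡ suc (bump k) ℕ.* G (suc (bump k)) + (suc n ∸ bump k) ℕ.* G (bump k)
positions-extending true  {k}     G _   = sym (ℕ.+-assoc (G (suc (suc k))) _ _)
positions-extending false {k} {n} G k≤n = begin
  G k + (A + (n ∸ k) ℕ.* G k)  ≡⟨ ℕ+.x∙yz≈y∙xz (G k) A _ ⟩
  A + (G k + (n ∸ k) ℕ.* G k)  ≡⟨ cong (λ t → A + t ℕ.* G k) (sym (ℕ.+-∸-assoc 1 k≤n)) ⟩
  A + (suc n ∸ k) ℕ.* G k      ∎
  where
  open ≡-Reasoning
  A : ℕ
  A = suc k ℕ.* G (suc k)

positions-cutting : ∀ d c K {k n} → k ℕ.≤ n → (c ≡ true → k ≡ n) →
  let k′ = if d ∧ c then suc k else k in
  𝟙[ K ≤ k′ ] + (suc n ∸ K) ℕ.* 𝟙[ K ≤ k ] ≡ (suc (suc n) ∸ K) ℕ.* 𝟙[ K ≤ k′ ]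
positions-cutting false _     K k≤n _ = 𝟙-absorb K (ℕ.m≤n⇒m≤1+n k≤n)
positions-cutting true  false K k≤n _ = 𝟙-absorb K (ℕ.m≤n⇒m≤1+n k≤n)
positions-cutting true  true  K {n = n} _ full rewrite full refl =
  trans (cong (𝟙[ K ≤ suc n ] +_) (𝟙-widen K n)) (𝟙-absorb K (ℕ.≤-refl {suc n}))

positions-extending-≥ : ∀ K {k n} → k ℕ.≤ n →
  suc k ℕ.* 𝟙[ K ≤ suc k ] + (n ∸ k) ℕ.* 𝟙[ K ≤ k ]
    ≡ (suc n ∸ K) ℕ.* 𝟙[ K ≤ k ] + K ℕ.* 𝟙[ K ≤ suc k ]
positions-extending-≥ zero {k} {n} k≤n = begin
  suc k ℕ.* 1 + (n ∸ k) ℕ.* 1  ≡⟨ cong₂ _+_ (ℕ.*-identityʳ (suc k)) (ℕ.*-identityʳ (n ∸ k)) ⟩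
  suc k + (n ∸ k)              ≡⟨ cong suc (ℕ.m+[n∸m]≡n k≤n) ⟩
  suc n                        ≡⟨ sym (trans (ℕ.+-identityʳ _) (ℕ.*-identityʳ (suc n))) ⟩
  suc n ℕ.* 1 + 0              ∎
  where open ≡-Reasoning
positions-extending-≥ (suc zero)    {zero} {n} _ rewrite ℕ.*-zeroʳ n = refl
positions-extending-≥ (suc (suc K)) {zero} {n} _ rewrite ℕ.*-zeroʳ n | ℕ.*-zeroʳ (n ∸ suc K) | ℕ.*-zeroʳ K = refl
positions-extending-≥ (suc K) {suc k} {suc n} (ℕ.s≤s k≤n) = begin
  (X + suc k ℕ.* X) + (n ∸ k) ℕ.* 𝟙[ K ≤ k ]  ≡⟨ ℕ.+-assoc X _ _ ⟩
  X + (suc k ℕ.* X + (n ∸ k) ℕ.* 𝟙[ K ≤ k ])  ≡⟨ cong (X +_) (positions-extending-≥ K k≤n) ⟩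
  X + ((suc n ∸ K) ℕ.* 𝟙[ K ≤ k ] + K ℕ.* X)  ≡⟨ ℕ+.x∙yz≈y∙xz X _ (K ℕ.* X) ⟩
  (suc n ∸ K) ℕ.* 𝟙[ K ≤ k ] + (X + K ℕ.* X)  ∎
  where
  open ≡-Reasoning
  X : ℕ
  X = 𝟙[ K ≤ suc k ]

module _ {X : Set} (p : X → Bool) where

  trailing : List X → ℕ
  trailing []      = 0
  trailing (u ∷ w) = if p u ∧ all p w then suc (trailing w) else trailing w

  count : List X → ℕ
  count []      = 0
  count (u ∷ w) = if p u then suc (count w) else count w

  trailing≤length : ∀ w → trailing w ℕ.≤ length w
  trailing≤length []      = ℕ.z≤n
  trailing≤length (u ∷ w) with p u ∧ all p w
  ... | true  = ℕ.s≤s (trailing≤length w)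
  ... | false = ℕ.m≤n⇒m≤1+n (trailing≤length w)

  trailing-all : ∀ w → all p w ≡ true → trailing w ≡ length w
  trailing-all []      _ = refl
  trailing-all (u ∷ w) h with p u | all p w in eq
  trailing-all (u ∷ w) h  | true  | true  = cong suc (trailing-all w eq)
  trailing-all (u ∷ w) () | true  | false
  trailing-all (u ∷ w) () | false | _

  count≤length : ∀ w → count w ℕ.≤ length w
  count≤length []      = ℕ.z≤n
  count≤length (u ∷ w) with p u
  ... | true  = ℕ.s≤s (count≤length w)
  ... | false = ℕ.m≤n⇒m≤1+n (count≤length w)

  all-insertAll : ∀ v τ → All (λ w → all p w ≡ p v ∧ all p τ) (insertAll v τ)
  all-insertAll v []      = refl ∷ []
  all-insertAll v (u ∷ τ) =
    refl ∷ map⁺ (All.map (λ eq → trans (cong (p u ∧_) eq) (∧.x∙yz≈y∙xz (p u) (p v) (all p τ)))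
                         (all-insertAll v τ))

  sum-map-∷-insertAll : ∀ {v b} → p v ≡ b → ∀ u τ (G : ℕ → ℕ) →
    sum (map (G ∘ trailing) (map (u ∷_) (insertAll v τ)))
      ≡ sum (map (λ w → G (if b ∧ all p (u ∷ τ) then suc (trailing w) else trailing w)) (insertAll v τ))
  sum-map-∷-insertAll {v} {b} pv u τ G = trans (cong sum (sym (map-∘ (insertAll v τ))))
    (cong sum (map-cong-local (All.map (λ eq → cong (λ β → G (if β then _ else _))
                                                     (trans (cong (p u ∧_) (trans eq (cong (_∧ all p τ) pv)))
                                                            (∧.x∙yz≈y∙xz (p u) b (all p τ))))
                                       (all-insertAll v τ))))

  sum-insertAll-extending : ∀ {v} → p v ≡ true → ∀ τ (G : ℕ → ℕ) → let k = trailing τ in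
    sum (map (G ∘ trailing) (insertAll v τ)) ≡ suc k ℕ.* G (suc k) + (length τ ∸ k) ℕ.* G k
  sum-insertAll-extending pv []      G rewrite pv = sym (ℕ.+-identityʳ _)
  sum-insertAll-extending {v} pv (u ∷ τ) G rewrite pv = begin
      G (bump (bump k)) + sum (map (G ∘ trailing) (map (u ∷_) (insertAll v τ)))
    ≡⟨ cong (G (bump (bump k)) +_) (trans (sum-map-∷-insertAll pv u τ G)
                                          (sum-insertAll-extending pv τ (G ∘ bump))) ⟩
      G (bump (bump k)) + (suc k ℕ.* G (bump (suc k)) + (length τ ∸ k) ℕ.* G (bump k))
    ≡⟨ positions-extending (p u ∧ all p τ) G (trailing≤length τ) ⟩
      suc (bump k) ℕ.* G (suc (bump k)) + (suc (length τ) ∸ bump k) ℕ.* G (bump k) ∎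
    where
    open ≡-Reasoning
    k : ℕ
    k = trailing τ
    bump : ℕ → ℕ
    bump t = if p u ∧ all p τ then suc t else t

  sum-insertAll-cutting : ∀ {v} → p v ≡ false → ∀ K τ →
    sum (map (𝟙[ K ≤_] ∘ trailing) (insertAll v τ)) ≡ (suc (length τ) ∸ K) ℕ.* 𝟙[ K ≤ trailing τ ]
  sum-insertAll-cutting _  zero    []      = refl
  sum-insertAll-cutting pv (suc K) []      rewrite pv = sym (ℕ.*-zeroʳ (0 ∸ K))
  sum-insertAll-cutting {v} pv K (u ∷ τ) rewrite pv = begin
      𝟙[ K ≤ k′ ] + sum (map (𝟙[ K ≤_] ∘ trailing) (map (u ∷_) (insertAll v τ)))
    ≡⟨ cong (𝟙[ K ≤ k′ ] +_) (trans (sum-map-∷-insertAll pv u τ 𝟙[ K ≤_])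
                                    (sum-insertAll-cutting pv K τ)) ⟩
      𝟙[ K ≤ k′ ] + (suc (length τ) ∸ K) ℕ.* 𝟙[ K ≤ trailing τ ]
    ≡⟨ positions-cutting (p u) (all p τ) K (trailing≤length τ) (trailing-all τ) ⟩
      (suc (suc (length τ)) ∸ K) ℕ.* 𝟙[ K ≤ k′ ] ∎
    where
    open ≡-Reasoning
    k′ : ℕ
    k′ = trailing (u ∷ τ)

  #trailing≥ : ℕ → List X → ℕ
  #trailing≥ K L = sum (map (𝟙[ K ≤_] ∘ trailing) (perms L))

  #trailing≥-extending : ∀ {v} → p v ≡ true → ∀ K L →
    #trailing≥ K (v ∷ L) ≡ (suc (length L) ∸ K) ℕ.* #trailing≥ K L + K ℕ.* #trailing≥ (K ∸ 1) L
  #trailing≥-extending {v} pv K L = begin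
      sum (map (𝟙[ K ≤_] ∘ trailing) (concatMap (insertAll v) (perms L)))
    ≡⟨ sum-map-concatMap (𝟙[ K ≤_] ∘ trailing) (insertAll v) (perms L) ⟩
      sum (map (λ τ → sum (map (𝟙[ K ≤_] ∘ trailing) (insertAll v τ))) (perms L))
    ≡⟨ cong sum (map-cong-local (All.map (λ {τ} → insert τ) (length-perms L))) ⟩
      sum (map (λ τ → (suc n ∸ K) ℕ.* 𝟙[ K ≤ trailing τ ] + K ℕ.* 𝟙[ K ∸ 1 ≤ trailing τ ]) (perms L))
    ≡⟨ sum-map-+ _ _ (perms L) ⟩
      sum (map (λ τ → (suc n ∸ K) ℕ.* 𝟙[ K ≤ trailing τ ]) (perms L))
        + sum (map (λ τ → K ℕ.* 𝟙[ K ∸ 1 ≤ trailing τ ]) (perms L))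
    ≡⟨ cong₂ _+_ (sum-map-*ˡ (suc n ∸ K) _ (perms L)) (sum-map-*ˡ K _ (perms L)) ⟩
      (suc n ∸ K) ℕ.* #trailing≥ K L + K ℕ.* #trailing≥ (K ∸ 1) L ∎
    where
    open ≡-Reasoning
    n : ℕ
    n = length L
    insert : ∀ τ → length τ ≡ n → sum (map (𝟙[ K ≤_] ∘ trailing) (insertAll v τ))
      ≡ (suc n ∸ K) ℕ.* 𝟙[ K ≤ trailing τ ] + K ℕ.* 𝟙[ K ∸ 1 ≤ trailing τ ]
    insert τ eq = trans (sum-insertAll-extending pv τ 𝟙[ K ≤_])
      (trans (positions-extending-≥ K (trailing≤length τ))
             (cong₂ (λ m i → (suc m ∸ K) ℕ.* 𝟙[ K ≤ trailing τ ] + K ℕ.* i) eq (𝟙-suc K (trailing τ))))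

  #trailing≥-cutting : ∀ {v} → p v ≡ false → ∀ K L →
    #trailing≥ K (v ∷ L) ≡ (suc (length L) ∸ K) ℕ.* #trailing≥ K L
  #trailing≥-cutting {v} pv K L = begin
      sum (map (𝟙[ K ≤_] ∘ trailing) (concatMap (insertAll v) (perms L)))
    ≡⟨ sum-map-concatMap (𝟙[ K ≤_] ∘ trailing) (insertAll v) (perms L) ⟩
      sum (map (λ τ → sum (map (𝟙[ K ≤_] ∘ trailing) (insertAll v τ))) (perms L))
    ≡⟨ cong sum (map-cong-local (All.map (λ {τ} eq → trans (sum-insertAll-cutting pv K τ)
                                                           (cong (λ m → (suc m ∸ K) ℕ.* 𝟙[ K ≤ trailing τ ]) eq))
                                         (length-perms L))) ⟩
      sum (map (λ τ → (suc (length L) ∸ K) ℕ.* 𝟙[ K ≤ trailing τ ]) (perms L))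
    ≡⟨ sum-map-*ˡ (suc (length L) ∸ K) _ (perms L) ⟩
      (suc (length L) ∸ K) ℕ.* #trailing≥ K L ∎
    where open ≡-Reasoning

  #trailing≥≡arrangements : ∀ K L → #trailing≥ K L ≡ arrangements (count L) (length L) K
  #trailing≥≡arrangements zero    []      = refl
  #trailing≥≡arrangements (suc K) []      = refl
  #trailing≥≡arrangements K       (v ∷ L) with p v in pv
  ... | true  = trans (#trailing≥-extending pv K L)
    (trans (cong₂ (λ s t → (suc (length L) ∸ K) ℕ.* s + K ℕ.* t)
                  (#trailing≥≡arrangements K L) (#trailing≥≡arrangements (K ∸ 1) L))
           (arrangements-suc-suc K (count≤length L)))
  ... | false = trans (#trailing≥-cutting pv K L)
    (trans (cong ((suc (length L) ∸ K) ℕ.*_) (#trailing≥≡arrangements K L))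
           (arrangements-suc K (count≤length L)))

-- Abel summation over the length of the trailing run

fromℕ : ℕ → ℚ
fromℕ n = n × 1ℚ

fromℕ-+ : ∀ m n → fromℕ (m + n) ≡ fromℕ m ℚ.+ fromℕ n
fromℕ-+ = ×-homo-+ 1ℚ

fromℕ-* : ∀ m n → fromℕ (m ℕ.* n) ≡ fromℕ m * fromℕ n
fromℕ-* = ×1-homo-*

toℚᵘ-fromℕ : ∀ n → ℚ.toℚᵘ (fromℕ n) ℚᵘ.≃ ℚᵘ.mkℚᵘ (ℤ.+_ n) 0
toℚᵘ-fromℕ zero    = ℚᵘ.*≡* refl
toℚᵘ-fromℕ (suc n) = ℚᵘ.≃-trans (ℚ.toℚᵘ-homo-+ 1ℚ (fromℕ n))
  (ℚᵘ.≃-trans (ℚᵘ.+-congʳ ℚᵘ.1ℚᵘ (toℚᵘ-fromℕ n)) (ℚᵘ.*≡* (add (ℤ.+_ n))))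
  where
  add : ∀ m → (ℤ.1ℤ ℤ.* ℤ.1ℤ ℤ.+ m ℤ.* ℤ.1ℤ) ℤ.* ℤ.1ℤ
              ≡ (ℤ.1ℤ ℤ.+ m) ℤ.* (ℤ.1ℤ ℤ.* ℤ.1ℤ)
  add = ℤ-solve-∀

-- `_/_` normalises by a gcd, so the product is computed in ℚᵘ.
1/n*n≡1 : ∀ n .{{_ : ℕ.NonZero n}} → (ℤ.1ℤ / n) * fromℕ n ≡ 1ℚ
1/n*n≡1 (suc k) = ℚ.toℚᵘ-injective (ℚᵘ.≃-trans (ℚ.toℚᵘ-homo-* (ℤ.1ℤ / suc k) (fromℕ (suc k)))
  (ℚᵘ.≃-trans (ℚᵘ.*-cong (ℚ.toℚᵘ-fromℚᵘ (ℚᵘ.mkℚᵘ ℤ.1ℤ k)) (toℚᵘ-fromℕ (suc k)))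
              (ℚᵘ.*≡* (mul (ℤ.+_ (suc k))))))
  where
  mul : ∀ m → (ℤ.1ℤ ℤ.* m) ℤ.* ℤ.1ℤ ≡ ℤ.1ℤ ℤ.* (m ℤ.* ℤ.1ℤ)
  mul = ℤ-solve-∀

sumℚ-map-+ : ∀ {X : Set} (f g : X → ℚ) xs →
  sumℚ (map (λ x → f x ℚ.+ g x) xs) ≡ sumℚ (map f xs) ℚ.+ sumℚ (map g xs)
sumℚ-map-+ f g []       = refl
sumℚ-map-+ f g (x ∷ xs) = trans (cong (f x ℚ.+ g x ℚ.+_) (sumℚ-map-+ f g xs)) (ℚ+.interchange (f x) (g x) _ _)

sumℚ-map-*-fromℕ : ∀ {X : Set} c (f : X → ℕ) xs →
  sumℚ (map (λ x → c * fromℕ (f x)) xs) ≡ c * fromℕ (sum (map f xs))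
sumℚ-map-*-fromℕ c f []       = sym (ℚ.*-zeroʳ c)
sumℚ-map-*-fromℕ c f (x ∷ xs) = begin
  c * fromℕ (f x) ℚ.+ sumℚ (map (λ x → c * fromℕ (f x)) xs)
    ≡⟨ cong (c * fromℕ (f x) ℚ.+_) (sumℚ-map-*-fromℕ c f xs) ⟩
  c * fromℕ (f x) ℚ.+ c * fromℕ (sum (map f xs))
    ≡⟨ sym (ℚ.*-distribˡ-+ c _ _) ⟩
  c * (fromℕ (f x) ℚ.+ fromℕ (sum (map f xs)))
    ≡⟨ cong (c *_) (sym (fromℕ-+ (f x) _)) ⟩
  c * fromℕ (f x + sum (map f xs)) ∎
  where open ≡-Reasoning

∑≤ : ℕ → (ℕ → ℚ) → ℚ
∑≤ zero    f = f zero
∑≤ (suc N) f = ∑≤ N f ℚ.+ f (suc N)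

syntax ∑≤ N (λ K → e) = ∑[ K ≤ N ] e

∑-cong : ∀ N {f g : ℕ → ℚ} → (∀ K → f K ≡ g K) → ∑≤ N f ≡ ∑≤ N g
∑-cong zero    f≗g = f≗g zero
∑-cong (suc N) f≗g = cong₂ ℚ._+_ (∑-cong N f≗g) (f≗g (suc N))

∑-+ : ∀ N (f g : ℕ → ℚ) → ∑[ K ≤ N ] (f K ℚ.+ g K) ≡ ∑≤ N f ℚ.+ ∑≤ N g
∑-+ zero    f g = refl
∑-+ (suc N) f g =
  trans (cong (ℚ._+ (f (suc N) ℚ.+ g (suc N))) (∑-+ N f g)) (ℚ+.interchange (∑≤ N f) (∑≤ N g) _ _)

∑-*ˡ : ∀ N c (f : ℕ → ℚ) → ∑[ K ≤ N ] (c * f K) ≡ c * ∑≤ N f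
∑-*ˡ zero    c f = refl
∑-*ˡ (suc N) c f = trans (cong (ℚ._+ c * f (suc N)) (∑-*ˡ N c f)) (sym (ℚ.*-distribˡ-+ c _ _))

∑-vanishing-top : ∀ N (f : ℕ → ℚ) → f (suc N) ≡ 0ℚ → ∑≤ (suc N) f ≡ ∑≤ N f
∑-vanishing-top N f f0 = trans (cong (∑≤ N f ℚ.+_) f0) (ℚ.+-identityʳ (∑≤ N f))

sumℚ-∑-comm : ∀ {X : Set} N (h : X → ℕ → ℚ) xs →
  sumℚ (map (λ x → ∑≤ N (h x)) xs) ≡ ∑[ K ≤ N ] sumℚ (map (λ x → h x K) xs)
sumℚ-∑-comm zero    h xs = refl
sumℚ-∑-comm (suc N) h xs =
  trans (sumℚ-map-+ (λ x → ∑≤ N (h x)) (λ x → h x (suc N)) xs)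
        (cong (ℚ._+ sumℚ (map (λ x → h x (suc N)) xs)) (sumℚ-∑-comm N h xs))

Δ : (ℕ → ℚ) → ℕ → ℚ
Δ g zero    = g zero
Δ g (suc K) = g (suc K) ℚ.- g K

Δ-telescope : ∀ (g : ℕ → ℚ) N k → ∑[ K ≤ N ] (Δ g K * fromℕ 𝟙[ K ≤ k ]) ≡ g (N ℕ.⊓ k)
Δ-telescope g zero    k = ℚ.*-identityʳ (g 0)
Δ-telescope g (suc N) k with suc N ℕ.≤? k
... | yes N<k rewrite Δ-telescope g N k | ℕ.m≤n⇒m⊓n≡m (ℕ.<⇒≤ N<k) | ℕ.m≤n⇒m⊓n≡m N<k | 𝟙-≤ N<k =
  cancel (g N) (g (suc N))
  where
  open +-*-Solver
  cancel : ∀ u v → u ℚ.+ (v ℚ.- u) * fromℕ 1 ≡ v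
  cancel = solve 2 (λ u v → u :+ (v :- u) :* con 1ℚ := v) refl
... | no  N≮k rewrite Δ-telescope g N k | ℕ.m≥n⇒m⊓n≡n (ℕ.≮⇒≥ N≮k)
                    | ℕ.m≥n⇒m⊓n≡n (ℕ.≤-trans (ℕ.≮⇒≥ N≮k) (ℕ.n≤1+n N)) | 𝟙-> (ℕ.≰⇒> N≮k) =
  trans (cong (g k ℚ.+_) (ℚ.*-zeroʳ (Δ g (suc N)))) (ℚ.+-identityʳ (g k))

∑-Δ-concentrated : ∀ (g : ℕ → ℚ) N k M (f : ℕ → ℕ) → k ℕ.≤ N → (∀ K → f K ≡ M ℕ.* 𝟙[ K ≤ k ]) →
  ∑[ K ≤ N ] (Δ g K * fromℕ (f K)) ≡ fromℕ M * g k
∑-Δ-concentrated g N k M f k≤N f≡ = begin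
    ∑[ K ≤ N ] (Δ g K * fromℕ (f K))
  ≡⟨ ∑-cong N (λ K → trans (cong (λ t → Δ g K * t) (trans (cong fromℕ (f≡ K)) (fromℕ-* M _)))
                           (ℚ*.x∙yz≈y∙xz (Δ g K) (fromℕ M) _)) ⟩
    ∑[ K ≤ N ] (fromℕ M * (Δ g K * fromℕ 𝟙[ K ≤ k ]))
  ≡⟨ ∑-*ˡ N (fromℕ M) _ ⟩
    fromℕ M * ∑[ K ≤ N ] (Δ g K * fromℕ 𝟙[ K ≤ k ])
  ≡⟨ cong (fromℕ M *_) (trans (Δ-telescope g N k) (cong g (ℕ.m≥n⇒m⊓n≡n k≤N))) ⟩
    fromℕ M * g k ∎
  where open ≡-Reasoning

sumℚ-trailing : ∀ {X : Set} (p : X → Bool) (g : ℕ → ℚ) L →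
  sumℚ (map (g ∘ trailing p) (perms L))
    ≡ ∑[ K ≤ length L ] (Δ g K * fromℕ (arrangements (count p L) (length L) K))
sumℚ-trailing p g L = begin
    sumℚ (map (g ∘ trailing p) (perms L))
  ≡⟨ cong sumℚ (map-cong-local (All.map (λ {σ} → telescope σ) (length-perms L))) ⟩
    sumℚ (map (λ σ → ∑[ K ≤ n ] (Δ g K * fromℕ 𝟙[ K ≤ trailing p σ ])) (perms L))
  ≡⟨ sumℚ-∑-comm n (λ σ K → Δ g K * fromℕ 𝟙[ K ≤ trailing p σ ]) (perms L) ⟩
    ∑[ K ≤ n ] sumℚ (map (λ σ → Δ g K * fromℕ 𝟙[ K ≤ trailing p σ ]) (perms L))
  ≡⟨ ∑-cong n (λ K → trans (sumℚ-map-*-fromℕ (Δ g K) (𝟙[ K ≤_] ∘ trailing p) (perms L))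
                           (cong (λ t → Δ g K * fromℕ t) (#trailing≥≡arrangements p K L))) ⟩
    ∑[ K ≤ n ] (Δ g K * fromℕ (arrangements (count p L) n K)) ∎
  where
  open ≡-Reasoning
  n : ℕ
  n = length L
  telescope : ∀ σ → length σ ≡ n → g (trailing p σ) ≡ ∑[ K ≤ n ] (Δ g K * fromℕ 𝟙[ K ≤ trailing p σ ])
  telescope σ eq = sym (trans (Δ-telescope g n (trailing p σ))
                              (cong g (ℕ.m≥n⇒m⊓n≡n (subst (trailing p σ ℕ.≤_) eq (trailing≤length p σ)))))

-- The first-vertex recursion

activitySum : ℚ → ℕ → ℕ → ℚ
activitySum x a b = ∑[ K ≤ a + b ] (Δ (x ^_) K * fromℕ (arrangements a (a + b) K))

module _ (x : ℚ) where

  activitySum-lattice : ∀ a b →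
    activitySum x (suc a) (suc b)
      ≡ fromℕ (suc a) * activitySum x a (suc b) ℚ.+ fromℕ (suc b) * activitySum x (suc a) b
  activitySum-lattice a b = begin
      ∑[ K ≤ suc n ] term (suc a) (suc b) K
    ≡⟨ ∑-vanishing-top n (term (suc a) (suc b)) top ⟩
      ∑[ K ≤ n ] term (suc a) (suc b) K
    ≡⟨ ∑-cong n split ⟩
      ∑[ K ≤ n ] (fromℕ (suc a) * term a (suc b) K ℚ.+ fromℕ (suc b) * term (suc a) b K)
    ≡⟨ ∑-+ n _ _ ⟩
      ∑[ K ≤ n ] (fromℕ (suc a) * term a (suc b) K) ℚ.+ ∑[ K ≤ n ] (fromℕ (suc b) * term (suc a) b K)
    ≡⟨ cong₂ ℚ._+_ (∑-*ˡ n (fromℕ (suc a)) (term a (suc b)))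
                   (trans (∑-*ˡ n (fromℕ (suc b)) (term (suc a) b))
                          (cong (λ m → fromℕ (suc b) * ∑≤ m (term (suc a) b)) (ℕ.+-suc a b))) ⟩
      fromℕ (suc a) * activitySum x a (suc b) ℚ.+ fromℕ (suc b) * activitySum x (suc a) b ∎
    where
    open ≡-Reasoning
    n : ℕ
    n = a + suc b
    term : ℕ → ℕ → ℕ → ℚ
    term a b K = Δ (x ^_) K * fromℕ (arrangements a (a + b) K)
    top : term (suc a) (suc b) (suc n) ≡ 0ℚ
    top rewrite falling-vanish {suc a} {suc n} (ℕ.s≤s (ℕ.m<m+n a (ℕ.s≤s ℕ.z≤n))) =
      ℚ.*-zeroʳ (Δ (x ^_) (suc n))
    distrib : ∀ d s t u v → d * (s * u ℚ.+ t * v) ≡ s * (d * u) ℚ.+ t * (d * v)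
    distrib = solve 5 (λ d s t u v → d :* (s :* u :+ t :* v) := s :* (d :* u) :+ t :* (d :* v)) refl
      where open +-*-Solver
    split : ∀ K → term (suc a) (suc b) K ≡ fromℕ (suc a) * term a (suc b) K ℚ.+ fromℕ (suc b) * term (suc a) b K
    split K rewrite arrangements-lattice a b K
                  | fromℕ-+ (suc a ℕ.* arrangements a (a + suc b) K) (suc b ℕ.* arrangements (suc a) (suc a + b) K)
                  | fromℕ-* (suc a) (arrangements a (a + suc b) K)
                  | fromℕ-* (suc b) (arrangements (suc a) (suc a + b) K) =
      distrib (Δ (x ^_) K) (fromℕ (suc a)) (fromℕ (suc b)) _ _

  activitySum-onlyA : ∀ a → activitySum x a 0 ≡ fromℕ (a !) * x ^ a
  activitySum-onlyA a rewrite ℕ.+-identityʳ a =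
    ∑-Δ-concentrated (x ^_) a a (a !) (arrangements a a) ℕ.≤-refl (arrangements-all a)

  activitySum-onlyB : ∀ b → activitySum x 0 b ≡ fromℕ (b !)
  activitySum-onlyB b =
    trans (∑-Δ-concentrated (x ^_) b 0 (b !) (arrangements 0 b) ℕ.z≤n (arrangements-none b)) (ℚ.*-identityʳ _)

binomialTail : ℕ → ℕ → ℕ
binomialTail a       zero    = 2 ℕ.^ a
binomialTail zero    (suc b) = 1
binomialTail (suc a) (suc b) = binomialTail a (suc b) + binomialTail (suc a) b

binomialTail-pos : ∀ a b → 1 ℕ.≤ binomialTail a b
binomialTail-pos a       zero    = ℕ.m^n>0 2 a
binomialTail-pos zero    (suc b) = ℕ.≤-refl
binomialTail-pos (suc a) (suc b) = ℕ.≤-trans (binomialTail-pos (suc a) b) (ℕ.m≤n+m _ _)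

binomialTail-anti : ∀ a b → binomialTail a (suc b) ℕ.≤ binomialTail (suc a) b
binomialTail-anti zero    zero    = ℕ.s≤s ℕ.z≤n
binomialTail-anti zero    (suc b) = ℕ.≤-trans (binomialTail-pos 1 b) (ℕ.m≤n+m _ _)
binomialTail-anti (suc a) zero    =
  ℕ.≤-trans (ℕ.+-monoˡ-≤ (2 ℕ.^ suc a) (binomialTail-anti a zero))
            (ℕ.≤-reflexive (cong (2 ℕ.^ suc a +_) (sym (ℕ.+-identityʳ (2 ℕ.^ suc a)))))
binomialTail-anti (suc a) (suc b) = ℕ.+-mono-≤ (binomialTail-anti a (suc b)) (binomialTail-anti (suc a) b)

weight : ℕ → ℕ → ℕ
weight a b = a ! ℕ.* b ! ℕ.* binomialTail a b

weight-lattice : ∀ a b → weight (suc a) (suc b) ≡ suc a ℕ.* weight a (suc b) + suc b ℕ.* weight (suc a) b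
weight-lattice a b = expand (suc a) (suc b) (a !) (b !) (binomialTail a (suc b)) (binomialTail (suc a) b)
  where
  expand : ∀ s t f g T U →
    s ℕ.* f ℕ.* (t ℕ.* g) ℕ.* (T + U) ≡ s ℕ.* (f ℕ.* (t ℕ.* g) ℕ.* T) + t ℕ.* (s ℕ.* f ℕ.* g ℕ.* U)
  expand = solve-∀

weight-step : ∀ a b → suc a ℕ.* weight a (suc b) ℕ.≤ suc b ℕ.* weight (suc a) b
weight-step a b = begin
  suc a ℕ.* weight a (suc b)
    ≡⟨ reassocˡ (suc a) (suc b) (a !) (b !) (binomialTail a (suc b)) ⟩
  suc a ! ℕ.* suc b ! ℕ.* binomialTail a (suc b)
    ≤⟨ ℕ.*-monoʳ-≤ (suc a ! ℕ.* suc b !) (binomialTail-anti a b) ⟩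
  suc a ! ℕ.* suc b ! ℕ.* binomialTail (suc a) b
    ≡⟨ sym (reassocʳ (suc a) (suc b) (a !) (b !) (binomialTail (suc a) b)) ⟩
  suc b ℕ.* weight (suc a) b ∎
  where
  open ℕ.≤-Reasoning
  reassocˡ : ∀ s t f g T → s ℕ.* (f ℕ.* (t ℕ.* g) ℕ.* T) ≡ s ℕ.* f ℕ.* (t ℕ.* g) ℕ.* T
  reassocˡ = solve-∀
  reassocʳ : ∀ s t f g T → t ℕ.* (s ℕ.* f ℕ.* g ℕ.* T) ≡ s ℕ.* f ℕ.* (t ℕ.* g) ℕ.* T
  reassocʳ = solve-∀

factorial≤weight : ∀ a b → (a + b) ! ℕ.≤ weight a b
factorial≤weight a zero rewrite ℕ.+-identityʳ a =
  ℕ.≤-trans (ℕ.≤-reflexive (sym (trans (ℕ.*-identityʳ (a ! ℕ.* 1)) (ℕ.*-identityʳ (a !)))))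
            (ℕ.*-monoʳ-≤ (a ! ℕ.* 1) (ℕ.m^n>0 2 a))
factorial≤weight zero (suc b) = ℕ.≤-reflexive (sym (trans (ℕ.*-identityʳ _) (ℕ.+-identityʳ _)))
factorial≤weight (suc a) (suc b) = begin
  (suc a + suc b) ℕ.* (a + suc b) !
    ≡⟨ ℕ.*-distribʳ-+ _ (suc a) (suc b) ⟩
  suc a ℕ.* (a + suc b) ! + suc b ℕ.* (a + suc b) !
    ≤⟨ ℕ.+-mono-≤ (ℕ.*-monoʳ-≤ (suc a) (factorial≤weight a (suc b))) (ℕ.*-monoʳ-≤ (suc b) IH) ⟩
  suc a ℕ.* weight a (suc b) + suc b ℕ.* weight (suc a) b
    ≡⟨ sym (weight-lattice a b) ⟩
  weight (suc a) (suc b) ∎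
  where
  open ℕ.≤-Reasoning
  IH : (a + suc b) ! ℕ.≤ weight (suc a) b
  IH = subst (λ n → n ! ℕ.≤ weight (suc a) b) (sym (ℕ.+-suc a b)) (factorial≤weight (suc a) b)

-- The weighted lower bound

0<1 : 0ℚ < 1ℚ
0<1 = ℚ.positive⁻¹ 1ℚ

0≤fromℕ : ∀ n → 0ℚ ≤ fromℕ n
0≤fromℕ zero    = ℚ.≤-refl
0≤fromℕ (suc n) = ℚ.+-mono-≤ (ℚ.<⇒≤ 0<1) (0≤fromℕ n)

p≤p+q : ∀ p {q} → 0ℚ ≤ q → p ≤ p ℚ.+ q
p≤p+q p {q} 0≤q = subst (_≤ p ℚ.+ q) (ℚ.+-identityʳ p) (ℚ.+-monoʳ-≤ p 0≤q)

p≤q⇒0≤q-p : ∀ {p q} → p ≤ q → 0ℚ ≤ q ℚ.- p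
p≤q⇒0≤q-p {p} {q} p≤q = subst (_≤ q ℚ.- p) (ℚ.+-inverseʳ p) (ℚ.+-monoˡ-≤ (ℚ.- p) p≤q)

fromℕ-mono : ∀ {m n} → m ℕ.≤ n → fromℕ m ≤ fromℕ n
fromℕ-mono {m} {n} m≤n =
  subst (fromℕ m ≤_) (trans (sym (fromℕ-+ m (n ∸ m))) (cong fromℕ (ℕ.m+[n∸m]≡n m≤n)))
        (p≤p+q (fromℕ m) (0≤fromℕ (n ∸ m)))

0≤⇒*-monoˡ-≤ : ∀ {r p q} → 0ℚ ≤ r → p ≤ q → r * p ≤ r * q
0≤⇒*-monoˡ-≤ {r} 0≤r = ℚ.*-monoˡ-≤-nonNeg r {{ℚ.nonNegative 0≤r}}

0≤⇒*-monoʳ-≤ : ∀ {r p q} → 0ℚ ≤ r → p ≤ q → p * r ≤ q * r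
0≤⇒*-monoʳ-≤ {r} 0≤r = ℚ.*-monoʳ-≤-nonNeg r {{ℚ.nonNegative 0≤r}}

0≤* : ∀ {p q} → 0ℚ ≤ p → 0ℚ ≤ q → 0ℚ ≤ p * q
0≤* {p} {q} 0≤p 0≤q = subst (_≤ p * q) (ℚ.*-zeroˡ q) (0≤⇒*-monoʳ-≤ 0≤q 0≤p)

0≤⇒*-mono-≤ : ∀ {p q r s} → 0ℚ ≤ p → 0ℚ ≤ s → p ≤ q → r ≤ s → p * r ≤ q * s
0≤⇒*-mono-≤ 0≤p 0≤s p≤q r≤s = ℚ.≤-trans (0≤⇒*-monoˡ-≤ 0≤p r≤s) (0≤⇒*-monoʳ-≤ 0≤s p≤q)

^-nonNeg : ∀ {p} n → 0ℚ ≤ p → 0ℚ ≤ p ^ n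
^-nonNeg zero    _   = ℚ.<⇒≤ 0<1
^-nonNeg (suc n) 0≤p = 0≤* 0≤p (^-nonNeg n 0≤p)

^-pos : ∀ {p} n → 0ℚ < p → 0ℚ < p ^ n
^-pos         zero    _   = 0<1
^-pos {p} (suc n) 0<p =
  subst (_< p * p ^ n) (ℚ.*-zeroˡ (p ^ n)) (ℚ.*-monoˡ-<-pos (p ^ n) {{ℚ.positive (^-pos n 0<p)}} 0<p)

^-mono-≤ : ∀ {p q} n → 0ℚ ≤ p → p ≤ q → p ^ n ≤ q ^ n
^-mono-≤ zero    _   _   = ℚ.≤-refl
^-mono-≤ (suc n) 0≤p p≤q =
  0≤⇒*-mono-≤ 0≤p (^-nonNeg n (ℚ.≤-trans 0≤p p≤q)) p≤q (^-mono-≤ n 0≤p p≤q)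

^-distribʳ-* : ∀ p q n → (p * q) ^ n ≡ p ^ n * q ^ n
^-distribʳ-* p q zero    = refl
^-distribʳ-* p q (suc n) = trans (cong (p * q *_) (^-distribʳ-* p q n)) (ℚ*.interchange p q (p ^ n) (q ^ n))

^-homo-* : ∀ p m n → p ^ (m + n) ≡ p ^ m * p ^ n
^-homo-* p zero    n = sym (ℚ.*-identityˡ (p ^ n))
^-homo-* p (suc m) n = trans (cong (p *_) (^-homo-* p m n)) (sym (ℚ.*-assoc p (p ^ m) (p ^ n)))

1^n≡1 : ∀ n → 1ℚ ^ n ≡ 1ℚ
1^n≡1 zero    = refl
1^n≡1 (suc n) = trans (ℚ.*-identityˡ (1ℚ ^ n)) (1^n≡1 n)

fromℕ-^ : ∀ m n → fromℕ (m ℕ.^ n) ≡ fromℕ m ^ n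
fromℕ-^ m zero    = refl
fromℕ-^ m (suc n) = trans (fromℕ-* m (m ℕ.^ n)) (cong (fromℕ m *_) (fromℕ-^ m n))

module _ (x : ℚ) (2≤x : 2ℚ ≤ x) where

  private
    y : ℚ
    y = x ℚ.- 1ℚ

    0≤x : 0ℚ ≤ x
    0≤x = ℚ.≤-trans (0≤fromℕ 2) 2≤x

    0≤y : 0ℚ ≤ y
    0≤y = p≤q⇒0≤q-p (ℚ.≤-trans (fromℕ-mono {1} {2} (ℕ.s≤s ℕ.z≤n)) 2≤x)

    x≤2y : x ≤ 2ℚ * y
    x≤2y = subst (x ≤_) (shift x) (p≤p+q x (p≤q⇒0≤q-p 2≤x))
      where
      open +-*-Solver
      shift : ∀ x → x ℚ.+ (x ℚ.- 2ℚ) ≡ 2ℚ * (x ℚ.- 1ℚ)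
      shift = solve 1 (λ x → x :+ (x :- con 2ℚ) := con 2ℚ :* (x :- con 1ℚ)) refl

    x[A+B]≤2A+2yB : ∀ {A B} → A ≤ B → x * (A ℚ.+ B) ≤ 2ℚ * A ℚ.+ 2ℚ * y * B
    x[A+B]≤2A+2yB {A} {B} A≤B =
      subst (x * (A ℚ.+ B) ≤_) (gap x A B) (p≤p+q _ (0≤* (p≤q⇒0≤q-p 2≤x) (p≤q⇒0≤q-p A≤B)))
      where
      open +-*-Solver
      gap : ∀ x A B → x * (A ℚ.+ B) ℚ.+ (x ℚ.- 2ℚ) * (B ℚ.- A) ≡ 2ℚ * A ℚ.+ 2ℚ * (x ℚ.- 1ℚ) * B
      gap = solve 3 (λ x A B → x :* (A :+ B) :+ (x :- con 2ℚ) :* (B :- A)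
                               := con 2ℚ :* A :+ con 2ℚ :* (x :- con 1ℚ) :* B) refl

  WeightedBound : ℕ → ℕ → Set
  WeightedBound a b = fromℕ (weight a b) * x ^ (a + b) ≤ 2ℚ ^ (a + b) * (x ℚ.- 1ℚ) ^ b * activitySum x a b

  weightedBound-onlyA : ∀ a → WeightedBound a 0
  weightedBound-onlyA a rewrite activitySum-onlyA x a | ℕ.+-identityʳ a =
    ℚ.≤-reflexive (trans (cong (_* x ^ a) (trans (fromℕ-* (a ! ℕ.* 1) (2 ℕ.^ a))
                                                 (cong₂ _*_ (fromℕ-* (a !) 1) (fromℕ-^ 2 a))))
                         (reorder (fromℕ (a !)) (2ℚ ^ a) (x ^ a)))
    where
    open +-*-Solver
    reorder : ∀ f P X → f * 1ℚ * P * X ≡ P * 1ℚ * (f * X)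
    reorder = solve 3 (λ f P X → f :* con 1ℚ :* P :* X := P :* con 1ℚ :* (f :* X)) refl

  weightedBound-onlyB : ∀ b → WeightedBound 0 (suc b)
  weightedBound-onlyB b rewrite activitySum-onlyB x (suc b) = begin
      fromℕ (1 ℕ.* suc b ! ℕ.* 1) * x ^ suc b
    ≡⟨ cong (λ n → fromℕ n * x ^ suc b) (trans (ℕ.*-identityʳ (1 ℕ.* suc b !)) (ℕ.*-identityˡ (suc b !))) ⟩
      fromℕ (suc b !) * x ^ suc b
    ≤⟨ 0≤⇒*-monoˡ-≤ (0≤fromℕ (suc b !)) (^-mono-≤ (suc b) 0≤x x≤2y) ⟩
      fromℕ (suc b !) * (2ℚ * y) ^ suc b
    ≡⟨ trans (cong (fromℕ (suc b !) *_) (^-distribʳ-* 2ℚ y (suc b))) (ℚ.*-comm (fromℕ (suc b !)) _) ⟩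
      2ℚ ^ suc b * y ^ suc b * fromℕ (suc b !) ∎
    where open ℚ.≤-Reasoning

  weightedBound-step : ∀ a b → WeightedBound a (suc b) → WeightedBound (suc a) b → WeightedBound (suc a) (suc b)
  weightedBound-step a b IH₁ IH₂ = begin
      fromℕ (weight (suc a) (suc b)) * (x * X)
    ≡⟨ cong (_* (x * X)) (trans (cong fromℕ (weight-lattice a b))
                                (trans (fromℕ-+ (suc a ℕ.* weight a (suc b)) (suc b ℕ.* weight (suc a) b))
                                       (cong₂ ℚ._+_ (fromℕ-* (suc a) (weight a (suc b)))
                                                    (fromℕ-* (suc b) (weight (suc a) b))))) ⟩
      (s * ω₁ ℚ.+ t * ω₂) * (x * X)
    ≡⟨ R₁ (s * ω₁) (t * ω₂) x X ⟩
      x * (s * ω₁ ℚ.+ t * ω₂) * X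
    ≤⟨ 0≤⇒*-monoʳ-≤ (^-nonNeg n 0≤x) (x[A+B]≤2A+2yB step) ⟩
      (2ℚ * (s * ω₁) ℚ.+ 2ℚ * y * (t * ω₂)) * X
    ≡⟨ R₂ s t ω₁ ω₂ y X ⟩
      2ℚ * s * (ω₁ * X) ℚ.+ 2ℚ * y * t * (ω₂ * X)
    ≤⟨ ℚ.+-mono-≤ (0≤⇒*-monoˡ-≤ (0≤* (0≤fromℕ 2) (0≤fromℕ (suc a))) IH₁)
                  (0≤⇒*-monoˡ-≤ (0≤* (0≤* (0≤fromℕ 2) 0≤y) (0≤fromℕ (suc b))) IH₂′) ⟩
      2ℚ * s * (P * (y * Y) * W₁) ℚ.+ 2ℚ * y * t * (P * Y * W₂)
    ≡⟨ R₃ s t P y Y W₁ W₂ ⟩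
      2ℚ * P * (y * Y) * (s * W₁ ℚ.+ t * W₂)
    ≡⟨ cong (2ℚ * P * (y * Y) *_) (sym (activitySum-lattice x a b)) ⟩
      2ℚ * P * (y * Y) * activitySum x (suc a) (suc b) ∎
    where
    open ℚ.≤-Reasoning
    open +-*-Solver using (solve; _:+_; _:*_; _:=_; con)
    n : ℕ
    X P Y s t ω₁ ω₂ W₁ W₂ : ℚ
    n = a + suc b
    X = x ^ n
    P = 2ℚ ^ n
    Y = y ^ b
    s = fromℕ (suc a)
    t = fromℕ (suc b)
    ω₁ = fromℕ (weight a (suc b))
    ω₂ = fromℕ (weight (suc a) b)
    W₁ = activitySum x a (suc b)
    W₂ = activitySum x (suc a) b
    IH₂′ : ω₂ * X ≤ P * Y * W₂
    IH₂′ = subst (λ n → ω₂ * x ^ n ≤ 2ℚ ^ n * Y * W₂) (sym (ℕ.+-suc a b)) IH₂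
    step : s * ω₁ ≤ t * ω₂
    step = subst₂ _≤_ (fromℕ-* (suc a) (weight a (suc b))) (fromℕ-* (suc b) (weight (suc a) b))
                  (fromℕ-mono (weight-step a b))
    R₁ : ∀ A B x X → (A ℚ.+ B) * (x * X) ≡ x * (A ℚ.+ B) * X
    R₁ = solve 4 (λ A B x X → (A :+ B) :* (x :* X) := x :* (A :+ B) :* X) refl
    R₂ : ∀ s t u v y X →
      (2ℚ * (s * u) ℚ.+ 2ℚ * y * (t * v)) * X ≡ 2ℚ * s * (u * X) ℚ.+ 2ℚ * y * t * (v * X)
    R₂ = solve 6 (λ s t u v y X → (con 2ℚ :* (s :* u) :+ con 2ℚ :* y :* (t :* v)) :* X
                                  := con 2ℚ :* s :* (u :* X) :+ con 2ℚ :* y :* t :* (v :* X)) refl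
    R₃ : ∀ s t P y Y U V → 2ℚ * s * (P * (y * Y) * U) ℚ.+ 2ℚ * y * t * (P * Y * V)
                           ≡ 2ℚ * P * (y * Y) * (s * U ℚ.+ t * V)
    R₃ = solve 7 (λ s t P y Y U V → con 2ℚ :* s :* (P :* (y :* Y) :* U) :+ con 2ℚ :* y :* t :* (P :* Y :* V)
                                    := con 2ℚ :* P :* (y :* Y) :* (s :* U :+ t :* V)) refl

  weightedBound : ∀ a b → WeightedBound a b
  weightedBound a       zero    = weightedBound-onlyA a
  weightedBound zero    (suc b) = weightedBound-onlyB b
  weightedBound (suc a) (suc b) = weightedBound-step a b (weightedBound a (suc b)) (weightedBound (suc a) b)

activitySum-lower-bound : ∀ x → 2ℚ ≤ x → ∀ a b →
  x ^ (a + b) ≤ 2ℚ ^ (a + b) * (x ℚ.- 1ℚ) ^ b * (activitySum x a b * (ℤ.1ℤ / (a + b) !) {{(a + b) !≢0}})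
activitySum-lower-bound x 2≤x a b = begin
    x ^ n
      ≡⟨ sym (trans (sym (ℚ.*-assoc q (fromℕ (n !)) (x ^ n)))
                    (trans (cong (_* x ^ n) (1/n*n≡1 (n !) {{n !≢0}})) (ℚ.*-identityˡ (x ^ n)))) ⟩
    q * (fromℕ (n !) * x ^ n)
      ≤⟨ 0≤⇒*-monoˡ-≤ 0≤q (ℚ.≤-trans (0≤⇒*-monoʳ-≤ (^-nonNeg n 0≤x) (fromℕ-mono (factorial≤weight a b)))
                                    (weightedBound x 2≤x a b)) ⟩
    q * (P * Y * W)
      ≡⟨ reorder q P Y W ⟩
    P * Y * (W * q) ∎
  where
  open ℚ.≤-Reasoning
  n : ℕ
  q P Y W : ℚ
  n = a + b
  q = (ℤ.1ℤ / n !) {{n !≢0}}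
  P = 2ℚ ^ n
  Y = (x ℚ.- 1ℚ) ^ b
  W = activitySum x a b
  0≤x : 0ℚ ≤ x
  0≤x = ℚ.≤-trans (0≤fromℕ 2) 2≤x
  0≤q : 0ℚ ≤ q
  0≤q = ℚ.nonNegative⁻¹ q {{ℚ.normalize-nonNeg 1 (n !) {{n !≢0}}}}
  reorder : ∀ q P Y W → q * (P * Y * W) ≡ P * Y * (W * q)
  reorder = solve 4 (λ q P Y W → q :* (P :* Y :* W) := P :* Y :* (W :* q)) refl
    where open +-*-Solver

-- Complete bipartite graphs

isInj₁ : {A B : Set} → A ⊎ B → Bool
isInj₁ (inj₁ _) = true
isInj₁ (inj₂ _) = false

isInj₂ : {A B : Set} → A ⊎ B → Bool
isInj₂ (inj₁ _) = false
isInj₂ (inj₂ _) = true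

count-isInj₁ : ∀ {A B : Set} (xs : List A) (ys : List B) →
  count isInj₁ (map inj₁ xs ++ map inj₂ ys) ≡ length xs
count-isInj₁ (_ ∷ xs) ys       = cong suc (count-isInj₁ xs ys)
count-isInj₁ []       []       = refl
count-isInj₁ []       (_ ∷ ys) = count-isInj₁ [] ys

count-isInj₂ : ∀ {A B : Set} (xs : List A) (ys : List B) →
  count isInj₂ (map inj₁ xs ++ map inj₂ ys) ≡ length ys
count-isInj₂ (_ ∷ xs) ys       = count-isInj₂ xs ys
count-isInj₂ []       []       = refl
count-isInj₂ []       (_ ∷ ys) = cong suc (count-isInj₂ [] ys)

module _ {a b : ℕ} where

  any-adj-inj₁ : ∀ i w → any (adj (K a b) (inj₁ i)) w ≡ not (all isInj₁ w)
  any-adj-inj₁ i []           = refl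
  any-adj-inj₁ i (inj₁ _ ∷ w) = any-adj-inj₁ i w
  any-adj-inj₁ i (inj₂ _ ∷ w) = refl

  any-adj-inj₂ : ∀ j w → any (adj (K a b) (inj₂ j)) w ≡ not (all isInj₂ w)
  any-adj-inj₂ j []           = refl
  any-adj-inj₂ j (inj₁ _ ∷ w) = refl
  any-adj-inj₂ j (inj₂ _ ∷ w) = any-adj-inj₂ j w

  ia≡trailing : ∀ σ → ia (K a b) σ ≡ trailing isInj₁ σ
  ia≡trailing []           = refl
  ia≡trailing (inj₂ _ ∷ w) = ia≡trailing w
  ia≡trailing (inj₁ i ∷ w) rewrite any-adj-inj₁ i w | ia≡trailing w with all isInj₁ w
  ... | true  = refl
  ... | false = refl

  ea≡trailing : ∀ σ → ea (K a b) σ ≡ trailing isInj₂ σ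
  ea≡trailing []           = refl
  ea≡trailing (inj₁ _ ∷ w) = ea≡trailing w
  ea≡trailing (inj₂ j ∷ w) rewrite any-adj-inj₂ j w | ea≡trailing w with all isInj₂ w
  ... | true  = refl
  ... | false = refl

module _ (a b : ℕ) (x : ℚ) where

  private
    V : List (Vertex (K a b))
    V = vertices (K a b)

    length-V : length V ≡ a + b
    length-V = trans (length-++ (map inj₁ (allFin a)))
      (cong₂ _+_ (trans (length-map inj₁ (allFin a)) (length-tabulate {n = a} (λ i → i)))
                 (trans (length-map inj₂ (allFin b)) (length-tabulate {n = b} (λ i → i))))

  sum-x^ia : sumℚ (map (λ σ → x ^ ia (K a b) σ * 1ℚ ^ ea (K a b) σ) (perms V)) ≡ activitySum x a b
  sum-x^ia = begin
      sumℚ (map (λ σ → x ^ ia (K a b) σ * 1ℚ ^ ea (K a b) σ) (perms V))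
    ≡⟨ cong sumℚ (map-cong (λ σ → trans (cong₂ _*_ (cong (x ^_) (ia≡trailing σ)) (1^n≡1 (ea (K a b) σ)))
                                        (ℚ.*-identityʳ _)) (perms V)) ⟩
      sumℚ (map ((x ^_) ∘ trailing isInj₁) (perms V))
    ≡⟨ sumℚ-trailing isInj₁ (x ^_) V ⟩
      ∑[ j ≤ length V ] (Δ (x ^_) j * fromℕ (arrangements (count isInj₁ V) (length V) j))
    ≡⟨ cong₂ (λ c n → ∑[ j ≤ n ] (Δ (x ^_) j * fromℕ (arrangements c n j)))
             (trans (count-isInj₁ (allFin a) (allFin b)) (length-tabulate {n = a} (λ i → i))) length-V ⟩
      activitySum x a b ∎
    where open ≡-Reasoning

  sum-x^ea : sumℚ (map (λ σ → 1ℚ ^ ia (K a b) σ * x ^ ea (K a b) σ) (perms V)) ≡ activitySum x b a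
  sum-x^ea = begin
      sumℚ (map (λ σ → 1ℚ ^ ia (K a b) σ * x ^ ea (K a b) σ) (perms V))
    ≡⟨ cong sumℚ (map-cong (λ σ → trans (cong₂ _*_ (1^n≡1 (ia (K a b) σ)) (cong (x ^_) (ea≡trailing σ)))
                                        (ℚ.*-identityˡ _)) (perms V)) ⟩
      sumℚ (map ((x ^_) ∘ trailing isInj₂) (perms V))
    ≡⟨ sumℚ-trailing isInj₂ (x ^_) V ⟩
      ∑[ j ≤ length V ] (Δ (x ^_) j * fromℕ (arrangements (count isInj₂ V) (length V) j))
    ≡⟨ cong₂ (λ c n → ∑[ j ≤ n ] (Δ (x ^_) j * fromℕ (arrangements c n j)))
             (trans (count-isInj₂ (allFin a) (allFin b)) (length-tabulate {n = b} (λ i → i)))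
             (trans length-V (ℕ.+-comm a b)) ⟩
      activitySum x b a ∎
    where open ≡-Reasoning

module _ (a b : ℕ) (x : ℚ) (2≤x : 2ℚ ≤ x) where

  T̃-x1-lower-bound : x ^ (a + b) ≤ 2ℚ ^ (a + b) * (x ℚ.- 1ℚ) ^ b * T̃ (K a b) x 1ℚ
  T̃-x1-lower-bound =
    subst (λ S → x ^ (a + b) ≤ 2ℚ ^ (a + b) * (x ℚ.- 1ℚ) ^ b * (S * (ℤ.1ℤ / (a + b) !) {{(a + b) !≢0}}))
          (sym (sum-x^ia a b x)) (activitySum-lower-bound x 2≤x a b)

  T̃-1x-lower-bound : x ^ (a + b) ≤ 2ℚ ^ (a + b) * (x ℚ.- 1ℚ) ^ a * T̃ (K a b) 1ℚ x
  T̃-1x-lower-bound =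
    subst₂ (λ n S → x ^ n ≤ 2ℚ ^ n * (x ℚ.- 1ℚ) ^ a * (S * (ℤ.1ℤ / n !) {{n !≢0}}))
           (ℕ.+-comm b a) (sym (sum-x^ea a b x)) (activitySum-lower-bound x 2≤x b a)

base*4[x-1]≡x*x : ∀ x (h : 2ℚ < x) → base x h * (4ℚ * (x ℚ.- 1ℚ)) ≡ x * x
base*4[x-1]≡x*x x h = trans (ℚ.*-assoc (x * x) _ (4ℚ * (x ℚ.- 1ℚ)))
  (trans (cong (x * x *_) (ℚ.*-inverseˡ (4ℚ * (x ℚ.- 1ℚ)) {{4[x-1]≢0 x h}})) (ℚ.*-identityʳ (x * x)))

0<4[x-1] : ∀ x → 2ℚ < x → 0ℚ < 4ℚ * (x ℚ.- 1ℚ)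
0<4[x-1] x h = ℚ.positive⁻¹ (4ℚ * (x ℚ.- 1ℚ)) {{ℚ.pos*pos⇒pos 4ℚ (x ℚ.- 1ℚ) {{ℚ.positive 0<x-1}}}}
  where
  0<x-1 : 0ℚ < x ℚ.- 1ℚ
  0<x-1 = subst (_< x ℚ.- 1ℚ) (ℚ.+-inverseʳ 1ℚ)
                (ℚ.+-monoˡ-< (ℚ.- 1ℚ) (ℚ.≤-<-trans (fromℕ-mono {1} {2} (ℕ.s≤s ℕ.z≤n)) h))

product-of-bounds : ∀ y a b S T →
  2ℚ ^ (a + b) * y ^ b * S * (2ℚ ^ (a + b) * y ^ a * T) ≡ S * T * (4ℚ * y) ^ (a + b)
product-of-bounds y a b S T = trans (gather (2ℚ ^ (a + b)) (y ^ a) (y ^ b) S T) (cong (S * T *_) (sym powers))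
  where
  powers : (4ℚ * y) ^ (a + b) ≡ 2ℚ ^ (a + b) * 2ℚ ^ (a + b) * (y ^ a * y ^ b)
  powers = trans (^-distribʳ-* 4ℚ y (a + b)) (cong₂ _*_ (^-distribʳ-* 2ℚ 2ℚ (a + b)) (^-homo-* y a b))
  gather : ∀ P A B S T → P * B * S * (P * A * T) ≡ S * T * (P * P * (A * B))
  gather = solve 5 (λ P A B S T → P :* B :* S :* (P :* A :* T) := S :* T :* (P :* P :* (A :* B))) refl
    where open +-*-Solver

mainTheorem16 : (a b : ℕ) → (x : ℚ) → (h : 2ℚ < x) →
    base x h ^ (a + b) ≤ T̃ (K a b) x 1ℚ * T̃ (K a b) 1ℚ x
mainTheorem16 a b x h = ℚ.*-cancelʳ-≤-pos ((4ℚ * y) ^ n) {{ℚ.positive (^-pos n (0<4[x-1] x h))}} (begin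
    base x h ^ n * (4ℚ * y) ^ n
      ≡⟨ trans (sym (^-distribʳ-* (base x h) (4ℚ * y) n))
               (trans (cong (_^ n) (base*4[x-1]≡x*x x h)) (^-distribʳ-* x x n)) ⟩
    x ^ n * x ^ n
      ≤⟨ 0≤⇒*-mono-≤ 0≤xⁿ (ℚ.≤-trans 0≤xⁿ bound₂) bound₁ bound₂ ⟩
    2ℚ ^ n * y ^ b * T₁ * (2ℚ ^ n * y ^ a * T₂)
      ≡⟨ product-of-bounds y a b T₁ T₂ ⟩
    T₁ * T₂ * (4ℚ * y) ^ n ∎)
  where
  open ℚ.≤-Reasoning
  n : ℕ
  y T₁ T₂ : ℚ
  n = a + b
  y = x ℚ.- 1ℚ
  T₁ = T̃ (K a b) x 1ℚ
  T₂ = T̃ (K a b) 1ℚ x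
  bound₁ : x ^ n ≤ 2ℚ ^ n * y ^ b * T₁
  bound₁ = T̃-x1-lower-bound a b x (ℚ.<⇒≤ h)
  bound₂ : x ^ n ≤ 2ℚ ^ n * y ^ a * T₂
  bound₂ = T̃-1x-lower-bound a b x (ℚ.<⇒≤ h)
  0≤xⁿ : 0ℚ ≤ x ^ n
  0≤xⁿ = ^-nonNeg n (ℚ.≤-trans (0≤fromℕ 2) (ℚ.<⇒≤ h))
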